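{- Let $n\geq k\geq 1$ and let $S\neq T$ be $k$-subsets of $[n]$. No edge $\{x,y\}$ of $h(S,T)$ (with $x\in[n]\setminus[k]$, $y\in[k]$) whose two endpoints both have degree two in $h(S,T)$ is such that $(x,y)$ is $(S,T)$-good.
   Context: $[m]=\{1,\dots,m\}$. For a $k$-subset $S$ of $[n]$ define $f(S)\subseteq([n]\setminus[k])\times[k]$: if $S=[k]$ then $f(S)=\emptyset$; otherwise let $S\setminus[k]=\{x_1,\dots,x_t\}$ with $n\geq x_1>\dots>x_t\geq k+1$ and $[k]\setminus S=\{y_1,\dots,y_t\}$ with $1\leq y_1<\dots<y_t\leq k$, and set $f(S)=\{(x_1,y_1),\dots,(x_t,y_t)\}$. Let $h(S)$ be the graph on $[n]$ whose edges are the pairs $\{x,y\}$ with $(x,y)\in f(S)$, and $h(S,T)$ the multigraph union of $h(S)$ and $h(T)$ (pairs in $f(S)\cap f(T)$ give double edges; degrees count multiplicity). For each $k$-subset $S$ and each $(x,y)\in([n]\setminus[k])\times[k]$ define $a(S,(x,y))\in\{0,1,*\}$ by the first applicable rule: (1) if $(x,y)\in f(S)$, then $1$; (2) else if $\max(S)<x$, then $0$; (3) else if there is $z<y$ with $(x,z)\in f(S)$, then $*$; (4) else if $y\in S$, then $0$; (5) else if there is $z<x$ with $(z,y)\in f(S)$, then $0$; (6) else $*$. A pair $(x,y)$ is $(S,T)$-good if $\{a(S,(x,y)),a(T,(x,y))\}=\{0,1\}$. -}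

module Defs where

open import Data.Bool using (Bool; true; false; if_then_else_; not; _∧_; _∨_)
open import Data.Nat using (ℕ; zero; suc; _≡ᵇ_; _<ᵇ_; _⊔_)
open import Data.List using (List; []; _∷_; filter; reverse; zip; length; foldr; map)
open import Data.Bool.ListAction using (any)
open import Data.Vec using (Vec; []; _∷_)
open import Data.Fin.Subset using (Subset)
open import Data.Product using (_×_; _,_; proj₁; proj₂)
open import Relation.Nullary.Decidable using (T?)
open import Relation.Binary.PropositionalEquality using (_≡_)
open import Data.Sum using (_⊎_)

-- A subset of [n] = {1,...,n} is an element of Subset n (= Vec Side n);
-- position i (0-based) of the vector stands for the element i+1.

elemsFrom : ∀ {m} → ℕ → Subset m → List ℕ
elemsFrom i [] = []
elemsFrom i (Data.Fin.Subset.inside ∷ v) = i ∷ elemsFrom (suc i) v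
elemsFrom i (Data.Fin.Subset.outside ∷ v) = elemsFrom (suc i) v

elems : ∀ {n} → Subset n → List ℕ
elems S = elemsFrom 1 S

_∈ᵇ_ : ∀ {n} → ℕ → Subset n → Bool
m ∈ᵇ S = any (m ≡ᵇ_) (elems S)

range : ℕ → List ℕ
range zero = []
range (suc m) = Data.List._++_ (range m) (suc m ∷ [])

-- max(S) (0 for the empty set)
maxS : ∀ {n} → Subset n → ℕ
maxS S = foldr _⊔_ 0 (elems S)

xsOf : ∀ {n} → ℕ → Subset n → List ℕ
xsOf k S = reverse (filter (λ x → T? (k <ᵇ x)) (elems S))

ysOf : ∀ {n} → ℕ → Subset n → List ℕ
ysOf k S = filter (λ y → T? (not (y ∈ᵇ S))) (range k)

f : ∀ {n} → ℕ → Subset n → List (ℕ × ℕ)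
f k S = zip (xsOf k S) (ysOf k S)

pairEq : ℕ × ℕ → ℕ × ℕ → Bool
pairEq (a , b) (c , d) = (a ≡ᵇ c) ∧ (b ≡ᵇ d)

_∈fᵇ_ : ℕ × ℕ → List (ℕ × ℕ) → Bool
p ∈fᵇ L = any (pairEq p) L

-- number of edges of h(S) incident to vertex v
degh : ∀ {n} → ℕ → Subset n → ℕ → ℕ
degh k S v = length (filter (λ p → T? ((proj₁ p ≡ᵇ v) ∨ (proj₂ p ≡ᵇ v))) (f k S))

-- degree of v in the multigraph h(S,T)
deg : ∀ {n} → ℕ → Subset n → Subset n → ℕ → ℕ
deg k S T v = degh k S v Data.Nat.+ degh k T v

data Val : Set where
  v0 v1 v* : Val

a : ∀ {n} → ℕ → Subset n → ℕ × ℕ → Val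
a k S (x , y) =
  if (x , y) ∈fᵇ f k S then v1                                        -- (1)
  else if maxS S <ᵇ x then v0                                           -- (2)
  else if any (λ p → (proj₁ p ≡ᵇ x) ∧ (proj₂ p <ᵇ y)) (f k S) then v*  -- (3)
  else if y ∈ᵇ S then v0                                                -- (4)
  else if any (λ p → (proj₁ p <ᵇ x) ∧ (proj₂ p ≡ᵇ y)) (f k S) then v0  -- (5)
  else v*                                                               -- (6)

Good : ∀ {n} → ℕ → Subset n → Subset n → ℕ × ℕ → Set
Good k S T p = (a k S p ≡ v0 × a k T p ≡ v1) ⊎ (a k S p ≡ v1 × a k T p ≡ v0)

-- The pairs of f(S) list the elements of S \ [k] in decreasing and those of [k] \ S in
-- increasing order, so all first coordinates are distinct, all second coordinates are
-- distinct, and f(S) is the graph of a strictly decreasing map. Hence every vertex has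
-- degree at most one in h(S), and an edge (x, y) of h(S) whose endpoints have degree two in
-- h(S,T) forces edges (x, u) and (w, y) of h(T). Then a(S,(x,y)) = 1, while a(T,(x,y)) ≠ 0:
-- rule (2) fails as x ∈ T, rule (4) fails as y ∉ T, and rule (5) can only fire when w < x,
-- but then u < y, so rule (3) has already fired.
module Submission where

open import Defs
open import Data.Nat using (ℕ; _≤_)
open import Data.Product using (_×_; _,_)
open import Data.Sum using (_⊎_)
open import Data.Fin.Subset using (Subset; ∣_∣)
open import Data.List.Membership.Propositional using (_∈_)
open import Relation.Binary.PropositionalEquality using (_≡_; _≢_)
open import Relation.Nullary using (¬_)

open import Data.Bool using (Bool; true; false; T; not; _∧_; _∨_)
open import Data.Bool.Properties using (T-≡; T-∧; T-∨; T-not-≡)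
open import Data.Bool.ListAction using (any)
open import Data.Empty using (⊥-elim)
open import Data.List using (List; []; _∷_; filter; reverse; zip; length; foldr)
open import Data.List.Properties using (unfold-reverse)
open import Data.List.Membership.Propositional using (find)
open import Data.List.Membership.Propositional.Properties using (∈-filter⁻)
open import Data.List.Relation.Unary.All as All using (All; []; _∷_)
open import Data.List.Relation.Unary.All.Properties using (all-filter) renaming (++⁺ to All-++⁺)
open import Data.List.Relation.Unary.AllPairs using (AllPairs; []; _∷_)
import Data.List.Relation.Unary.AllPairs.Properties as AllPairs
open import Data.List.Relation.Unary.Any as Any using (here; there)
open import Data.List.Relation.Unary.Any.Properties using (any⁺; any⁻; reverse⁻)
open import Data.Nat using (zero; suc; _<_; _<?_; _+_; _⊔_; _≡ᵇ_; _<ᵇ_; z≤n; s≤s)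
open import Data.Nat.Properties
open import Data.Product using (∃; proj₁; proj₂)
open import Data.Product.Relation.Binary.Pointwise.NonDependent using (Pointwise)
open import Data.Sum using (inj₁; inj₂)
open import Data.Vec using ([]; _∷_)
open import Function using (flip; _∘_)
open import Function.Bundles using (Equivalence)
open import Level using (0ℓ)
open import Relation.Binary using (Rel)
open import Relation.Binary.PropositionalEquality using (refl; sym; trans; subst)
open import Relation.Nullary using (contradiction; yes; no)
open import Relation.Nullary.Decidable using (T?)
open import Relation.Unary using (Pred; Decidable)

open Equivalence using (to; from)

private
  variable
    A B : Set
    P : Pred A 0ℓ
    R Q : Rel A 0ℓ
    α β : A
    xs : List A
    ys : List B

∈-zip⁻ : (α , β) ∈ zip xs ys → α ∈ xs × β ∈ ys
∈-zip⁻ {xs = _ ∷ _} {ys = _ ∷ _} (here refl) = here refl , here refl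
∈-zip⁻ {xs = _ ∷ _} {ys = _ ∷ _} (there ab∈) with ∈-zip⁻ ab∈
... | a∈ , b∈ = there a∈ , there b∈

AllPairs-zip : {R : Rel A 0ℓ} {Q : Rel B 0ℓ} →
               AllPairs R xs → AllPairs Q ys → AllPairs (Pointwise R Q) (zip xs ys)
AllPairs-zip [] _ = []
AllPairs-zip (_ ∷ _) [] = []
AllPairs-zip (Rx ∷ Rxs) (Qy ∷ Qys) =
  All.tabulate (λ { {_ , _} ab∈ → let a∈ , b∈ = ∈-zip⁻ ab∈ in All.lookup Rx a∈ , All.lookup Qy b∈ })
  ∷ AllPairs-zip Rxs Qys

AllPairs-reverse : AllPairs R xs → AllPairs (flip R) (reverse xs)
AllPairs-reverse {xs = []} [] = []
AllPairs-reverse {xs = x ∷ xs} (Rx ∷ Rxs) rewrite unfold-reverse x xs =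
  AllPairs.++⁺ (AllPairs-reverse Rxs) ([] ∷ [])
               (All.tabulate (λ y∈ → All.lookup Rx (reverse⁻ y∈) ∷ []))

AllPairs-∈-trichotomy : AllPairs R xs → α ∈ xs → β ∈ xs → α ≡ β ⊎ R α β ⊎ R β α
AllPairs-∈-trichotomy (_ ∷ _) (here refl) (here refl) = inj₁ refl
AllPairs-∈-trichotomy (Rx ∷ _) (here refl) (there b∈) = inj₂ (inj₁ (All.lookup Rx b∈))
AllPairs-∈-trichotomy (Rx ∷ _) (there a∈) (here refl) = inj₂ (inj₂ (All.lookup Rx a∈))
AllPairs-∈-trichotomy (_ ∷ Rxs) (there a∈) (there b∈) = AllPairs-∈-trichotomy Rxs a∈ b∈

AllPairs-map-All : (∀ {u w} → P u → P w → R u w → Q u w) → All P xs → AllPairs R xs → AllPairs Q xs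
AllPairs-map-All imp [] [] = []
AllPairs-map-All imp (Pu ∷ Ps) (Ru ∷ Rs) =
  All.zipWith (λ (Pw , Ruw) → imp Pu Pw Ruw) (Ps , Ru) ∷ AllPairs-map-All imp Ps Rs

length-filter≤1 : (P? : Decidable P) → AllPairs (λ u w → P u → ¬ P w) xs → length (filter P? xs) ≤ 1
length-filter≤1 {P = P} {xs = xs} P? excl = go (AllPairs.filter⁺ P? excl) (all-filter P? xs)
  where
  go : ∀ {zs} → AllPairs (λ u w → P u → ¬ P w) zs → All P zs → length zs ≤ 1
  go [] [] = z≤n
  go (_ ∷ []) _ = s≤s z≤n
  go ((excl ∷ _) ∷ _) (Pu ∷ Pw ∷ _) = contradiction Pw (excl Pu)

1≤length-filter⇒∃ : (P? : Decidable P) → 1 ≤ length (filter P? xs) → ∃ λ x → x ∈ xs × P x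
1≤length-filter⇒∃ {xs = xs} P? nonempty with filter P? xs in eq
... | x ∷ _ = x , ∈-filter⁻ P? (subst (x ∈_) (sym eq) (here refl))

∈⇒T-any : (p : A → Bool) → α ∈ xs → T (p α) → T (any p xs)
∈⇒T-any p α∈ pα = any⁺ p (Any.map (λ { refl → pα }) α∈)

T-any⇒∃ : (p : A → Bool) → T (any p xs) → ∃ λ x → x ∈ xs × T (p x)
T-any⇒∃ {xs = xs} p = find ∘ any⁻ p xs

∈⇒≤foldr-⊔ : ∀ {m ns} → m ∈ ns → m ≤ foldr _⊔_ 0 ns
∈⇒≤foldr-⊔ {ns = n ∷ _} (here refl) = m≤m⊔n n _
∈⇒≤foldr-⊔ {ns = n ∷ _} (there m∈) = m≤n⇒m≤o⊔n n (∈⇒≤foldr-⊔ m∈)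

≤⇒≮ᵇ : ∀ {m n} → m ≤ n → (n <ᵇ m) ≡ false
≤⇒≮ᵇ {m} {n} m≤n with n <ᵇ m in n<ᵇm
... | false = refl
... | true = contradiction (<ᵇ⇒< n m (from T-≡ n<ᵇm)) (≤⇒≯ m≤n)

m+n≡2⇒m≤1⇒1≤n : ∀ {m n} → m + n ≡ 2 → m ≤ 1 → 1 ≤ n
m+n≡2⇒m≤1⇒1≤n {zero} refl _ = s≤s z≤n
m+n≡2⇒m≤1⇒1≤n {suc zero} refl _ = s≤s z≤n
m+n≡2⇒m≤1⇒1≤n {suc (suc _)} _ (s≤s ())

elemsFrom-≥ : ∀ {m} i (S : Subset m) → All (i ≤_) (elemsFrom i S)
elemsFrom-≥ i [] = []
elemsFrom-≥ i (true ∷ S) = ≤-refl ∷ All.map (≤-trans (n≤1+n i)) (elemsFrom-≥ (suc i) S)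
elemsFrom-≥ i (false ∷ S) = All.map (≤-trans (n≤1+n i)) (elemsFrom-≥ (suc i) S)

elemsFrom-ascending : ∀ {m} i (S : Subset m) → AllPairs _<_ (elemsFrom i S)
elemsFrom-ascending i [] = []
elemsFrom-ascending i (true ∷ S) = elemsFrom-≥ (suc i) S ∷ elemsFrom-ascending (suc i) S
elemsFrom-ascending i (false ∷ S) = elemsFrom-ascending (suc i) S

range-≤ : ∀ k → All (_≤ k) (range k)
range-≤ zero = []
range-≤ (suc k) = All-++⁺ (All.map m≤n⇒m≤1+n (range-≤ k)) (≤-refl ∷ [])

range-ascending : ∀ k → AllPairs _<_ (range k)
range-ascending zero = []
range-ascending (suc k) =
  AllPairs.++⁺ (range-ascending k) ([] ∷ []) (All.map (λ i≤k → s≤s i≤k ∷ []) (range-≤ k))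

-- u ≺ w : w has the smaller first and the larger second coordinate, as for a later pair of f(S).
_≺_ : Rel (ℕ × ℕ) _
_≺_ = Pointwise (flip _<_) _<_

Edge : ℕ → ℕ × ℕ → Set
Edge k (x , y) = k < x × y ≤ k

module _ {n} (k : ℕ) (S : Subset n) where

  f-sorted : AllPairs _≺_ (f k S)
  f-sorted = AllPairs-zip
    (AllPairs-reverse (AllPairs.filter⁺ (λ x → T? (k <ᵇ x)) (elemsFrom-ascending 1 S)))
    (AllPairs.filter⁺ (λ y → T? (not (y ∈ᵇ S))) (range-ascending k))

  ∈xsOf⁻ : ∀ {x} → x ∈ xsOf k S → x ∈ elems S × k < x
  ∈xsOf⁻ {x} x∈ with ∈-filter⁻ (λ x → T? (k <ᵇ x)) (reverse⁻ x∈)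
  ... | x∈S , k<ᵇx = x∈S , <ᵇ⇒< k x k<ᵇx

  ∈ysOf⁻ : ∀ {y} → y ∈ ysOf k S → y ≤ k × y ∈ᵇ S ≡ false
  ∈ysOf⁻ y∈ with ∈-filter⁻ (λ y → T? (not (y ∈ᵇ S))) y∈
  ... | y∈[k] , y∉S = All.lookup (range-≤ k) y∈[k] , to T-not-≡ y∉S

  ∈f⇒Edge : ∀ {u} → u ∈ f k S → Edge k u
  ∈f⇒Edge {_ , _} u∈ = proj₂ (∈xsOf⁻ (proj₁ (∈-zip⁻ u∈))) , proj₁ (∈ysOf⁻ (proj₂ (∈-zip⁻ u∈)))

  ∈f⇒x∈S : ∀ {x y} → (x , y) ∈ f k S → x ∈ elems S
  ∈f⇒x∈S = proj₁ ∘ ∈xsOf⁻ ∘ proj₁ ∘ ∈-zip⁻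

  ∈f⇒y∉S : ∀ {x y} → (x , y) ∈ f k S → y ∈ᵇ S ≡ false
  ∈f⇒y∉S = proj₂ ∘ ∈ysOf⁻ ∘ proj₂ ∘ ∈-zip⁻

  f-antitone : ∀ {x u w y} → (x , u) ∈ f k S → (w , y) ∈ f k S → w < x → u < y
  f-antitone xu∈ wy∈ w<x with AllPairs-∈-trichotomy f-sorted xu∈ wy∈
  ... | inj₁ refl = contradiction w<x (<-irrefl refl)
  ... | inj₂ (inj₁ (_ , u<y)) = u<y
  ... | inj₂ (inj₂ (x<w , _)) = contradiction w<x (<-asym x<w)

incidentᵇ : ℕ → ℕ × ℕ → Bool
incidentᵇ v u = (proj₁ u ≡ᵇ v) ∨ (proj₂ u ≡ᵇ v)

Incident : ℕ → ℕ × ℕ → Set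
Incident v = T ∘ incidentᵇ v

incident-x : ∀ {k v x y} → Edge k (x , y) → k < v → Incident v (x , y) → x ≡ v
incident-x {x = x} {y} (_ , y≤k) k<v inc with to T-∨ inc
... | inj₁ x≡ᵇv = ≡ᵇ⇒≡ x _ x≡ᵇv
... | inj₂ y≡ᵇv = contradiction (subst (_≤ _) (≡ᵇ⇒≡ y _ y≡ᵇv) y≤k) (<⇒≱ k<v)

incident-y : ∀ {k v x y} → Edge k (x , y) → v ≤ k → Incident v (x , y) → y ≡ v
incident-y {x = x} {y} (k<x , _) v≤k inc with to T-∨ inc
... | inj₁ x≡ᵇv = contradiction (subst (_ <_) (≡ᵇ⇒≡ x _ x≡ᵇv) k<x) (≤⇒≯ v≤k)
... | inj₂ y≡ᵇv = ≡ᵇ⇒≡ y _ y≡ᵇv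

incident-unique : ∀ {k v u w} → Edge k u → Edge k w → u ≺ w → Incident v u → ¬ Incident v w
incident-unique {k} {v} eu ew (w₁<u₁ , u₂<w₂) incu incw with k <? v
... | yes k<v = <-irrefl (trans (incident-x ew k<v incw) (sym (incident-x eu k<v incu))) w₁<u₁
... | no k≮v = <-irrefl (trans (incident-y eu (≮⇒≥ k≮v) incu) (sym (incident-y ew (≮⇒≥ k≮v) incw))) u₂<w₂

degh≤1 : ∀ {n} k (S : Subset n) v → degh k S v ≤ 1
degh≤1 k S v = length-filter≤1 (λ u → T? (incidentᵇ v u))
  (AllPairs-map-All incident-unique (All.tabulate (∈f⇒Edge k S)) (f-sorted k S))

deg≡2⇒incidentᵀ : ∀ {n} k (S T : Subset n) v → deg k S T v ≡ 2 → ∃ λ u → u ∈ f k T × Incident v u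
deg≡2⇒incidentᵀ k S T v d≡2 =
  1≤length-filter⇒∃ (λ u → T? (incidentᵇ v u)) (m+n≡2⇒m≤1⇒1≤n d≡2 (degh≤1 k S v))

deg≡2⇒edgeᵀ-at-x : ∀ {n} k (S T : Subset n) {x} → k < x → deg k S T x ≡ 2 → ∃ λ u → (x , u) ∈ f k T
deg≡2⇒edgeᵀ-at-x k S T {x} k<x d≡2 with deg≡2⇒incidentᵀ k S T x d≡2
... | (x′ , u) , x′u∈ , inc with incident-x (∈f⇒Edge k T x′u∈) k<x inc
...   | refl = u , x′u∈

deg≡2⇒edgeᵀ-at-y : ∀ {n} k (S T : Subset n) {y} → y ≤ k → deg k S T y ≡ 2 → ∃ λ w → (w , y) ∈ f k T
deg≡2⇒edgeᵀ-at-y k S T {y} y≤k d≡2 with deg≡2⇒incidentᵀ k S T y d≡2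
... | (w , y′) , wy′∈ , inc with incident-y (∈f⇒Edge k T wy′∈) y≤k inc
...   | refl = w , wy′∈

∈f⇒a≡v1 : ∀ {n} k (S : Subset n) {x y} → (x , y) ∈ f k S → a k S (x , y) ≡ v1
∈f⇒a≡v1 k S {x} {y} xy∈ rewrite to T-≡ (∈⇒T-any (pairEq (x , y)) xy∈
  (from T-∧ (≡⇒≡ᵇ x x refl , ≡⇒≡ᵇ y y refl))) = refl

rule5⇒rule3 : ∀ {n} k (S : Subset n) {x u y} → (x , u) ∈ f k S →
              T (any (λ p → (proj₁ p <ᵇ x) ∧ (proj₂ p ≡ᵇ y)) (f k S)) →
              T (any (λ p → (proj₁ p ≡ᵇ x) ∧ (proj₂ p <ᵇ y)) (f k S))
rule5⇒rule3 k S {x} {y = y} xu∈ fired with T-any⇒∃ (λ p → (proj₁ p <ᵇ x) ∧ (proj₂ p ≡ᵇ y)) fired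
... | (w , y′) , wy′∈ , w<ᵇx∧y′≡ᵇy with to T-∧ w<ᵇx∧y′≡ᵇy
...   | w<ᵇx , y′≡ᵇy with ≡ᵇ⇒≡ y′ y y′≡ᵇy
...     | refl = ∈⇒T-any _ xu∈ (from T-∧ (≡⇒≡ᵇ x x refl , <⇒<ᵇ u<y))
  where
  u<y = f-antitone k S xu∈ wy′∈ (<ᵇ⇒< w x w<ᵇx)

a≢v0 : ∀ {n} k (S : Subset n) {x u w y} → (x , u) ∈ f k S → (w , y) ∈ f k S → a k S (x , y) ≢ v0
a≢v0 k S {x} {y = y} xu∈ wy∈
  rewrite ≤⇒≮ᵇ (∈⇒≤foldr-⊔ (∈f⇒x∈S k S xu∈)) | ∈f⇒y∉S k S wy∈
  with (x , y) ∈fᵇ f k S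
... | true = λ ()
... | false with any (λ p → (proj₁ p ≡ᵇ x) ∧ (proj₂ p <ᵇ y)) (f k S) in rule3
...   | true = λ ()
...   | false with any (λ p → (proj₁ p <ᵇ x) ∧ (proj₂ p ≡ᵇ y)) (f k S) in rule5
...     | true = ⊥-elim (subst T rule3 (rule5⇒rule3 k S xu∈ (from T-≡ rule5)))
...     | false = λ ()

edge-with-degree-two-ends-not-good : ∀ {n} k (S T : Subset n) {x y} → (x , y) ∈ f k S →
  deg k S T x ≡ 2 → deg k S T y ≡ 2 → ¬ Good k S T (x , y)
edge-with-degree-two-ends-not-good k S T xy∈ _ _ (inj₁ (aS≡v0 , _))
  with trans (sym (∈f⇒a≡v1 k S xy∈)) aS≡v0
... | ()
edge-with-degree-two-ends-not-good k S T xy∈ dx dy (inj₂ (_ , aT≡v0))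
  with ∈f⇒Edge k S xy∈
... | k<x , y≤k with deg≡2⇒edgeᵀ-at-x k S T k<x dx | deg≡2⇒edgeᵀ-at-y k S T y≤k dy
...   | _ , xu∈ | _ , wy∈ = a≢v0 k T xu∈ wy∈ aT≡v0

deg-comm : ∀ {n} k (S T : Subset n) v → deg k S T v ≡ deg k T S v
deg-comm k S T v = +-comm (degh k S v) (degh k T v)

Good-swap : ∀ {n} k (S T : Subset n) p → Good k S T p → Good k T S p
Good-swap k S T p (inj₁ (aS , aT)) = inj₂ (aT , aS)
Good-swap k S T p (inj₂ (aS , aT)) = inj₁ (aT , aS)

mainTheorem7 : (n k : ℕ) → 1 ≤ k → k ≤ n → (S T : Subset n) → ∣ S ∣ ≡ k → ∣ T ∣ ≡ k → S ≢ T →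
    (x y : ℕ) → ((x , y) ∈ f k S ⊎ (x , y) ∈ f k T) →
    deg k S T x ≡ 2 → deg k S T y ≡ 2 → ¬ Good k S T (x , y)
mainTheorem7 n k _ _ S T _ _ _ x y (inj₁ xy∈S) dx dy = edge-with-degree-two-ends-not-good k S T xy∈S dx dy
mainTheorem7 n k _ _ S T _ _ _ x y (inj₂ xy∈T) dx dy =
  edge-with-degree-two-ends-not-good k T S xy∈T (trans (deg-comm k T S x) dx) (trans (deg-comm k T S y) dy)
  ∘ Good-swap k S T (x , y)
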